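{- There exists a constant $A > 0$ such that for all $n \geq 1$, $\frac{A}{n}\,\mathrm{sf}(n-1)\, e^{n-1} \leq D_n$, where $\mathrm{sf}(k) = \prod_{i=0}^{k} i!$.
   Context: A directed ordered acyclic graph (DOAG) is a tuple $(V, E, (\prec_v)_{v \in V \cup \{\emptyset\}})$ where $V$ is a finite set of vertices, $E \subseteq V \times V$ is a set of edges such that $(V,E)$ is acyclic, for each $v \in V$, $\prec_v$ is a total order on the outgoing edges of $v$, and $\prec_\emptyset$ is a total order on the sources (vertices with no incoming edge). Two DOAGs are equal if there is a bijection of vertex sets preserving edges and all orders. $D_n$ is the number of DOAGs with $n$ vertices and any number of edges and sources. -}

module Defs where

open import Data.Nat as ℕ using (ℕ; zero; suc; _!)
open import Data.Nat.Properties using (_!≢0)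
open import Data.Integer using (+_)
open import Data.Rational as ℚ using (ℚ; _/_; 0ℚ)
open import Data.Fin using (Fin)
open import Data.List using (List; map; length)
open import Data.List.Membership.Propositional using (_∈_; _∉_)
open import Data.List.Relation.Unary.Unique.Propositional using (Unique)
open import Data.List.Relation.Unary.All using (All)
open import Data.List.Relation.Unary.AllPairs using (AllPairs)
open import Data.List.Relation.Unary.Any using (Any)
open import Data.Product using (Σ; _×_)
open import Function.Bundles using (_↔_; Inverse)
open import Relation.Binary.PropositionalEquality using (_≡_)
open import Relation.Nullary using (¬_)

-- The outgoing edges of v together with their total order ≺_v are encoded
-- by the duplicate-free list  out v  (listed in increasing ≺_v order);
-- the sources with their order ≺_∅ by the duplicate-free list  srcs.

data Path⁺ {n : ℕ} (out : Fin n → List (Fin n)) : Fin n → Fin n → Set where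
  edge : ∀ {u v} → v ∈ out u → Path⁺ out u v
  step : ∀ {u v w} → v ∈ out u → Path⁺ out v w → Path⁺ out u w

IsSource : {n : ℕ} → (Fin n → List (Fin n)) → Fin n → Set
IsSource {n} out v = (u : Fin n) → v ∉ out u

record DOAG (n : ℕ) : Set where
  field
    out        : Fin n → List (Fin n)
    out-unique : (v : Fin n) → Unique (out v)
    acyclic    : (v : Fin n) → ¬ Path⁺ out v v
    srcs       : List (Fin n)
    srcs-unique : Unique srcs
    srcs-sound : (v : Fin n) → v ∈ srcs → IsSource out v
    srcs-complete : (v : Fin n) → IsSource out v → v ∈ srcs

_≅_ : {n : ℕ} → DOAG n → DOAG n → Set
_≅_ {n} G H =
  Σ (Fin n ↔ Fin n) λ σ →
    ((v : Fin n) → map (Inverse.to σ) (DOAG.out G v) ≡ DOAG.out H (Inverse.to σ v))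
    × (map (Inverse.to σ) (DOAG.srcs G) ≡ DOAG.srcs H)

-- k is the number D_n of DOAGs with n vertices (up to isomorphism):
-- there is a list of k pairwise non-isomorphic DOAGs on n vertices such
-- that every DOAG on n vertices is isomorphic to one of them.
IsDOAGCount : ℕ → ℕ → Set
IsDOAGCount n k =
  Σ (List (DOAG n)) λ L →
    (length L ≡ k)
    × AllPairs (λ G H → ¬ (G ≅ H)) L
    × ((G : DOAG n) → Any (λ H → G ≅ H) L)

sf : ℕ → ℕ
sf zero    = 1
sf (suc k) = sf k ℕ.* (suc k) !

-- partial sums of the exponential series: expPartial x m = Σ_{j=0}^{m} x^j / j!
-- (e^x is the supremum over m of these, for x ≥ 0)
expPartial : ℕ → ℕ → ℚ
expPartial x zero    = ℚ.1ℚ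
expPartial x (suc m) =
  expPartial x m ℚ.+ ((+ (x ℕ.^ suc m)) / (suc m) ! ) {{suc m !≢0}}

fromℕ : ℕ → ℚ
fromℕ k = + k / 1

module Submission where

open import Defs

-- Restrict to ladders: DOAGs on the vertices 0, …, m whose only source is 0, whose edges all
-- point upwards and which contain every edge j → j + 1. In a ladder vertex j may point to any
-- duplicate-free list of the vertices above it that contains j + 1, so there are
-- ∏_{s<m} h(s) ladders, where h(s) = 1 + s·a(s) counts the arrangements of s + 1 letters
-- containing a fixed one and a(s) = Σ_{j≤s} s!/j! counts all arrangements of s letters. The path
-- 0 → 1 → ⋯ → m forces every isomorphism between ladders to be the identity, so D(m+1) is at
-- least the number of ladders.
-- For the estimate write e_M(x) = Σ_{k≤M} x^k/k!. The tail bound Σ_{j>s} 1/j! ≤ 1/(s·s!) gives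
-- s·s!·e_M(1) ≤ h(s), and expanding (x+1)^k binomially gives e_M(x+1) ≤ e_M(1)·e_M(x), hence
-- e_M(m) ≤ e_M(1)^m. As ∏_{s=1}^{m} s·s! = m!·sf(m), multiplying these bounds yields
-- sf(m)·m!·e_M(m) ≤ ∏_{s=1}^{m} h(s), and h(m) ≤ 3·(m+1)! leaves sf(m)·e_M(m) ≤ 3(m+1)·D(m+1).

module Estimates where

  open import Data.Nat
  open import Data.Nat.Properties
  open import Data.Nat.Combinatorics using (_C_; nCn≡1; nCk+nC[k+1]≡[n+1]C[k+1]; k>n⇒nCk≡0)
  open import Data.Nat.Tactic.RingSolver using (solve-∀)
  open import Data.Sum using (inj₁; inj₂)
  open import Function using (_∘_)
  open import Relation.Nullary using (yes; no)
  open import Relation.Binary.PropositionalEquality using (_≡_; refl; sym; trans; cong; cong₂)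
  open import Algebra.Properties.CommutativeSemigroup *-commutativeSemigroup
    using (x∙yz≈y∙xz; x∙yz≈z∙xy)
  open ≤-Reasoning

  -- the number of duplicate-free lists over s letters
  arrangements : ℕ → ℕ
  arrangements zero    = 1
  arrangements (suc s) = suc (suc s * arrangements s)

  -- the number of duplicate-free lists over s + 1 letters that contain a fixed letter
  arrangementsWith : ℕ → ℕ
  arrangementsWith zero    = 1
  arrangementsWith (suc s) = arrangements (suc s) + suc s * arrangementsWith s

  arrangementsWith≡1+s*arrangements : ∀ s → arrangementsWith s ≡ suc (s * arrangements s)
  arrangementsWith≡1+s*arrangements zero    = refl
  arrangementsWith≡1+s*arrangements (suc s) rewrite arrangementsWith≡1+s*arrangements s =
    rearrange s (arrangements s)
    where
    rearrange : ∀ s a → suc (suc s * a) + suc s * suc (s * a) ≡ suc (suc s * suc (suc s * a))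
    rearrange = solve-∀

  arrangements<3*! : ∀ m → arrangements m < 3 * m !
  arrangements<3*! zero          = s≤s (s≤s z≤n)
  arrangements<3*! (suc zero)    = ≤-refl
  arrangements<3*! (suc (suc m)) = begin
    suc (suc (suc (suc m) * a))     ≤⟨ s≤s (s≤s (m≤m+n _ m)) ⟩
    suc (suc (suc (suc m) * a + m)) ≡⟨ rearrange m a ⟩
    suc (suc m) * suc a             ≤⟨ *-monoʳ-≤ (suc (suc m)) (arrangements<3*! (suc m)) ⟩
    suc (suc m) * (3 * suc m !)     ≡⟨ x∙yz≈y∙xz (suc (suc m)) 3 (suc m !) ⟩
    3 * suc (suc m) !               ∎
    where
    a = arrangements (suc m)
    rearrange : ∀ m a → suc (suc (suc (suc m) * a + m)) ≡ suc (suc m) * suc a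
    rearrange = solve-∀

  arrangementsWith≤3*! : ∀ m → arrangementsWith m ≤ 3 * suc m !
  arrangementsWith≤3*! m = begin
    arrangementsWith m    ≡⟨ arrangementsWith≡1+s*arrangements m ⟩
    suc (m * a)           ≤⟨ s≤s (m≤m+n _ _) ⟩
    suc (m * a + (a + m)) ≡⟨ rearrange m a ⟩
    suc m * suc a         ≤⟨ *-monoʳ-≤ (suc m) (arrangements<3*! m) ⟩
    suc m * (3 * m !)     ≡⟨ x∙yz≈y∙xz (suc m) 3 (m !) ⟩
    3 * suc m !           ∎
    where
    a = arrangements m
    rearrange : ∀ m a → suc (m * a + (a + m)) ≡ suc m * suc a
    rearrange = solve-∀

  arrangements/!-mono : ∀ {k n} → k ≤ n → n ! * arrangements k ≤ k ! * arrangements n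
  arrangements/!-mono {k} k≤n = go (≤⇒≤′ k≤n)
    where
    go : ∀ {n} → k ≤′ n → n ! * arrangements k ≤ k ! * arrangements n
    go ≤′-refl = ≤-refl
    go {suc n} (≤′-step k≤n) = begin
      suc n * n ! * arrangements k   ≡⟨ *-assoc (suc n) (n !) _ ⟩
      suc n * (n ! * arrangements k) ≤⟨ *-monoʳ-≤ (suc n) (go k≤n) ⟩
      suc n * (k ! * arrangements n) ≡⟨ x∙yz≈y∙xz (suc n) (k !) _ ⟩
      k ! * (suc n * arrangements n) ≤⟨ *-monoʳ-≤ (k !) (n≤1+n _) ⟩
      k ! * arrangements (suc n)     ∎

  arrangementsWith/[n*n!]-step : ∀ n →
    n * arrangementsWith (suc n) ≤ suc n * suc n * arrangementsWith n
  arrangementsWith/[n*n!]-step n = begin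
    n * arrangementsWith (suc n)
      ≡⟨ cong (n *_) (arrangementsWith≡1+s*arrangements (suc n)) ⟩
    n * suc (suc n * arrangements (suc n))
      ≤⟨ n≤1+n _ ⟩
    suc (n * suc (suc n * arrangements (suc n)))
      ≡⟨ rearrange n (arrangements n) ⟩
    suc n * suc n * suc (n * arrangements n)
      ≡⟨ cong (suc n * suc n *_) (arrangementsWith≡1+s*arrangements n) ⟨
    suc n * suc n * arrangementsWith n ∎
    where
    rearrange : ∀ n a → suc (n * suc (suc n * suc (suc n * a))) ≡ suc n * suc n * suc (n * a)
    rearrange = solve-∀

  arrangementsWith/[n*n!]-antitone : ∀ {s n} → s ≤ n →
    s * s ! * arrangementsWith n ≤ n * n ! * arrangementsWith s
  arrangementsWith/[n*n!]-antitone {zero}  _   = z≤n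
  arrangementsWith/[n*n!]-antitone {suc s} s≤n = go (≤⇒≤′ s≤n)
    where
    S = suc s * suc s !
    H = arrangementsWith (suc s)
    go : ∀ {n} → suc s ≤′ n → S * arrangementsWith n ≤ n * n ! * H
    go ≤′-refl = ≤-refl
    go {suc n} (≤′-step s<n) = *-cancelˡ-≤ n {{>-nonZero (<-≤-trans z<s (≤′⇒≤ s<n))}} (begin
      n * (S * arrangementsWith (suc n))       ≡⟨ x∙yz≈y∙xz n S _ ⟩
      S * (n * arrangementsWith (suc n))       ≤⟨ *-monoʳ-≤ S (arrangementsWith/[n*n!]-step n) ⟩
      S * (suc n * suc n * arrangementsWith n) ≡⟨ x∙yz≈y∙xz S (suc n * suc n) _ ⟩
      suc n * suc n * (S * arrangementsWith n) ≤⟨ *-monoʳ-≤ (suc n * suc n) (go s<n) ⟩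
      suc n * suc n * (n * n ! * H)            ≡⟨ rearrange n (n !) H ⟩
      n * (suc n * suc n ! * H)                ∎)
      where
      rearrange : ∀ n f h → suc n * suc n * (n * f * h) ≡ n * (suc n * (suc n * f) * h)
      rearrange = solve-∀

  -- Read as a(M)/M! ≤ a(s)/s! + 1/(s·s!), i.e. e_M(1) ≤ h(s)/(s·s!).
  arrangements/!≤arrangementsWith/[s*s!] : ∀ s M →
    s * s ! * arrangements M ≤ M ! * arrangementsWith s
  arrangements/!≤arrangementsWith/[s*s!] zero      M = z≤n
  arrangements/!≤arrangementsWith/[s*s!] s@(suc _) M with ≤-total M s
  ... | inj₁ M≤s = begin
    s * s ! * arrangements M       ≡⟨ *-assoc s (s !) _ ⟩
    s * (s ! * arrangements M)     ≤⟨ *-monoʳ-≤ s (arrangements/!-mono M≤s) ⟩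
    s * (M ! * arrangements s)     ≡⟨ x∙yz≈y∙xz s (M !) _ ⟩
    M ! * (s * arrangements s)     ≤⟨ *-monoʳ-≤ (M !) (n≤1+n _) ⟩
    M ! * suc (s * arrangements s) ≡⟨ cong (M ! *_) (arrangementsWith≡1+s*arrangements s) ⟨
    M ! * arrangementsWith s       ∎
  ... | inj₂ s≤M = *-cancelˡ-≤ M {{>-nonZero (<-≤-trans z<s s≤M)}} (begin
    M * (s * s ! * arrangements M)     ≡⟨ x∙yz≈y∙xz M (s * s !) _ ⟩
    s * s ! * (M * arrangements M)     ≤⟨ *-monoʳ-≤ (s * s !) (n≤1+n _) ⟩
    s * s ! * suc (M * arrangements M) ≡⟨ cong (s * s ! *_) (arrangementsWith≡1+s*arrangements M) ⟨
    s * s ! * arrangementsWith M       ≤⟨ arrangementsWith/[n*n!]-antitone s≤M ⟩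
    M * M ! * arrangementsWith s       ≡⟨ *-assoc M (M !) _ ⟩
    M * (M ! * arrangementsWith s)     ∎)

  poly : (ℕ → ℕ) → ℕ → ℕ → ℕ
  poly c zero    x = 0
  poly c (suc n) x = poly c n x + c n * x ^ n

  poly-cong : ∀ {c d} n x → (∀ {i} → i < n → c i ≡ d i) → poly c n x ≡ poly d n x
  poly-cong zero    x c≡d = refl
  poly-cong (suc n) x c≡d =
    cong₂ _+_ (poly-cong n x (c≡d ∘ m<n⇒m<1+n)) (cong (_* x ^ n) (c≡d (n<1+n n)))

  poly-mono : ∀ {c d} n x → (∀ i → c i ≤ d i) → poly c n x ≤ poly d n x
  poly-mono zero    x c≤d = ≤-refl
  poly-mono (suc n) x c≤d = +-mono-≤ (poly-mono n x c≤d) (*-monoˡ-≤ (x ^ n) (c≤d n))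

  poly-scale : ∀ k c n x → poly (λ i → k * c i) n x ≡ k * poly c n x
  poly-scale k c zero    x = sym (*-zeroʳ k)
  poly-scale k c (suc n) x = begin-equality
    poly (λ i → k * c i) n x + k * c n * x ^ n ≡⟨ cong (_+ k * c n * x ^ n) (poly-scale k c n x) ⟩
    k * poly c n x + k * c n * x ^ n           ≡⟨ rearrange k (poly c n x) (c n) (x ^ n) ⟩
    k * (poly c n x + c n * x ^ n)             ∎
    where
    rearrange : ∀ k p a y → k * p + k * a * y ≡ k * (p + a * y)
    rearrange = solve-∀

  poly-+ : ∀ c d n x → poly (λ i → c i + d i) n x ≡ poly c n x + poly d n x
  poly-+ c d zero    x = refl
  poly-+ c d (suc n) x = begin-equality
    poly (λ i → c i + d i) n x + (c n + d n) * x ^ n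
      ≡⟨ cong (_+ (c n + d n) * x ^ n) (poly-+ c d n x) ⟩
    poly c n x + poly d n x + (c n + d n) * x ^ n
      ≡⟨ rearrange (poly c n x) (poly d n x) (c n) (d n) (x ^ n) ⟩
    poly c n x + c n * x ^ n + (poly d n x + d n * x ^ n) ∎
    where
    rearrange : ∀ p q a b y → p + q + (a + b) * y ≡ p + a * y + (q + b * y)
    rearrange = solve-∀

  shift : (ℕ → ℕ) → ℕ → ℕ
  shift c zero    = 0
  shift c (suc i) = c i

  poly-shift : ∀ c n x → x * poly c n x ≡ poly (shift c) (suc n) x
  poly-shift c zero    x = *-zeroʳ x
  poly-shift c (suc n) x = begin-equality
    x * (poly c n x + c n * x ^ n)             ≡⟨ rearrange x (poly c n x) (c n) (x ^ n) ⟩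
    x * poly c n x + c n * x ^ suc n           ≡⟨ cong (_+ c n * x ^ suc n) (poly-shift c n x) ⟩
    poly (shift c) (suc n) x + c n * x ^ suc n ∎
    where
    rearrange : ∀ x p a y → x * (p + a * y) ≡ x * p + a * (x * y)
    rearrange = solve-∀

  poly-extend : ∀ c n x → c n ≡ 0 → poly c (suc n) x ≡ poly c n x
  poly-extend c n x cn≡0 rewrite cn≡0 = +-identityʳ (poly c n x)

  binomial-theorem : ∀ n x → suc x ^ n ≡ poly (n C_) (suc n) x
  binomial-theorem zero    x = refl
  binomial-theorem (suc n) x = begin-equality
    suc x * suc x ^ n                                      ≡⟨ cong (suc x *_) (binomial-theorem n x) ⟩
    suc x * E                                              ≡⟨ +-comm E (x * E) ⟩
    x * E + E                                              ≡⟨ cong₂ _+_ (poly-shift (n C_) (suc n) x) E≡ ⟩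
    poly (shift (n C_)) (2 + n) x + poly (n C_) (2 + n) x ≡⟨ poly-+ (shift (n C_)) (n C_) (2 + n) x ⟨
    poly (λ i → shift (n C_) i + n C i) (2 + n) x          ≡⟨ poly-cong (2 + n) x (λ {i} _ → pascal i) ⟩
    poly (suc n C_) (2 + n) x                              ∎
    where
    E = poly (n C_) (suc n) x
    E≡ : E ≡ poly (n C_) (2 + n) x
    E≡ = sym (poly-extend (n C_) (suc n) x (k>n⇒nCk≡0 (n<1+n n)))
    pascal : ∀ i → shift (n C_) i + n C i ≡ suc n C i
    pascal zero    = refl
    pascal (suc i) = nCk+nC[k+1]≡[n+1]C[k+1] n i

  [1+n∸k]*[1+n]Ck≡[1+n]*nCk : ∀ n k → (suc n ∸ k) * (suc n C k) ≡ suc n * (n C k)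
  [1+n∸k]*[1+n]Ck≡[1+n]*nCk n       zero    = refl
  [1+n∸k]*[1+n]Ck≡[1+n]*nCk zero    (suc j)
    rewrite 0∸n≡0 j | k>n⇒nCk≡0 {0} {suc j} z<s = refl
  [1+n∸k]*[1+n]Ck≡[1+n]*nCk (suc n) (suc j) with j ≤? n
  ... | no j≰n rewrite m≤n⇒m∸n≡0 (≰⇒> j≰n) | k>n⇒nCk≡0 {suc n} {suc j} (s<s (≰⇒> j≰n)) =
    sym (*-zeroʳ (2 + n))
  ... | yes j≤n = begin-equality
    (suc n ∸ j) * (suc (suc n) C suc j)
      ≡⟨ cong ((suc n ∸ j) *_) (nCk+nC[k+1]≡[n+1]C[k+1] (suc n) j) ⟨
    (suc n ∸ j) * (suc n C j + Y)
      ≡⟨ *-distribˡ-+ (suc n ∸ j) (suc n C j) Y ⟩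
    (suc n ∸ j) * (suc n C j) + (suc n ∸ j) * Y
      ≡⟨ cong₂ _+_ ([1+n∸k]*[1+n]Ck≡[1+n]*nCk n j) (cong (_* Y) (+-∸-assoc 1 j≤n)) ⟩
    suc n * (n C j) + (Y + (n ∸ j) * Y)
      ≡⟨ cong (λ z → suc n * (n C j) + (Y + z)) ([1+n∸k]*[1+n]Ck≡[1+n]*nCk n (suc j)) ⟩
    suc n * (n C j) + (Y + suc n * (n C suc j))
      ≡⟨ rearrange (suc n) (n C j) (n C suc j) Y ⟩
    suc n * (n C j + n C suc j) + Y
      ≡⟨ cong (λ z → suc n * z + Y) (nCk+nC[k+1]≡[n+1]C[k+1] n j) ⟩
    suc n * Y + Y
      ≡⟨ +-comm (suc n * Y) Y ⟩
    (2 + n) * Y ∎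
    where
    Y = suc n C suc j
    rearrange : ∀ m a b y → m * a + (y + m * b) ≡ m * (a + b) + y
    rearrange = solve-∀

  C*-recurrence : ∀ (g : ℕ → ℕ) c → (∀ k → g (suc k) ≡ suc k * g k + c) → ∀ {M i} → i ≤ M →
    (suc M C i) * g (suc M ∸ i) ≡ suc M * ((M C i) * g (M ∸ i)) + c * (suc M C i)
  C*-recurrence g c g-rec {M} {i} i≤M = begin-equality
    C′ * g (suc M ∸ i)               ≡⟨ cong (λ k → C′ * g k) [1+M]∸i≡1+k ⟩
    C′ * g (suc k)                   ≡⟨ cong (C′ *_) (g-rec k) ⟩
    C′ * (suc k * g k + c)           ≡⟨ rearrange C′ (suc k) (g k) c ⟩
    suc k * C′ * g k + c * C′        ≡⟨ cong (λ z → z * C′ * g k + c * C′) [1+M]∸i≡1+k ⟨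
    (suc M ∸ i) * C′ * g k + c * C′  ≡⟨ cong (λ z → z * g k + c * C′) ([1+n∸k]*[1+n]Ck≡[1+n]*nCk M i) ⟩
    suc M * (M C i) * g k + c * C′   ≡⟨ cong (_+ c * C′) (*-assoc (suc M) (M C i) (g k)) ⟩
    suc M * ((M C i) * g k) + c * C′ ∎
    where
    C′ = suc M C i
    k = M ∸ i
    [1+M]∸i≡1+k : suc M ∸ i ≡ suc k
    [1+M]∸i≡1+k = +-∸-assoc 1 i≤M
    rearrange : ∀ x s a c → x * (s * a + c) ≡ s * x * a + c * x
    rearrange = solve-∀

  -- expSum M x = M!·e_M(x), so that arrangements M = expSum M 1
  expSum : ℕ → ℕ → ℕ
  expSum zero    x = 1
  expSum (suc M) x = suc M * expSum M x + x ^ suc M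

  expSum≡poly : ∀ M x → expSum M x ≡ poly (λ i → (M C i) * (M ∸ i) !) (suc M) x
  expSum≡poly zero    x = refl
  expSum≡poly (suc M) x = begin-equality
    suc M * expSum M x + x ^ suc M
      ≡⟨ cong (λ e → suc M * e + x ^ suc M) (expSum≡poly M x) ⟩
    suc M * poly c (suc M) x + x ^ suc M
      ≡⟨ cong₂ _+_ (poly-scale (suc M) c (suc M) x) (*-identityˡ (x ^ suc M)) ⟨
    poly (λ i → suc M * c i) (suc M) x + 1 * x ^ suc M
      ≡⟨ cong₂ _+_ (poly-cong (suc M) x (sym ∘ c′≡)) (cong (_* x ^ suc M) 1≡c′) ⟩
    poly c′ (suc M) x + c′ (suc M) * x ^ suc M ∎
    where
    c c′ : ℕ → ℕ
    c  i = (M C i) * (M ∸ i) !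
    c′ i = (suc M C i) * (suc M ∸ i) !
    c′≡ : ∀ {i} → i < suc M → c′ i ≡ suc M * c i
    c′≡ i<1+M = trans (C*-recurrence _! 0 (λ k → sym (+-identityʳ (suc k !))) (≤-pred i<1+M)) (+-identityʳ _)
    1≡c′ : 1 ≡ c′ (suc M)
    1≡c′ rewrite nCn≡1 (suc M) | n∸n≡0 M = refl

  expSum-suc≡poly : ∀ M x → expSum M (suc x) ≡ poly (λ i → (M C i) * arrangements (M ∸ i)) (suc M) x
  expSum-suc≡poly zero    x = refl
  expSum-suc≡poly (suc M) x = begin-equality
    suc M * expSum M (suc x) + suc x ^ suc M
      ≡⟨ cong₂ _+_ (cong (suc M *_) (expSum-suc≡poly M x)) (binomial-theorem (suc M) x) ⟩
    suc M * poly c (suc M) x + B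
      ≡⟨ cong (λ p → suc M * p + B) (poly-extend c (suc M) x c[1+M]≡0) ⟨
    suc M * poly c (2 + M) x + B
      ≡⟨ cong (_+ B) (poly-scale (suc M) c (2 + M) x) ⟨
    poly (λ i → suc M * c i) (2 + M) x + B
      ≡⟨ poly-+ (λ i → suc M * c i) (suc M C_) (2 + M) x ⟨
    poly (λ i → suc M * c i + suc M C i) (2 + M) x
      ≡⟨ poly-cong (2 + M) x (λ i<2+M → sym (c′≡ (≤-pred i<2+M))) ⟩
    poly c′ (2 + M) x ∎
    where
    B = poly (suc M C_) (2 + M) x
    c c′ : ℕ → ℕ
    c  i = (M C i) * arrangements (M ∸ i)
    c′ i = (suc M C i) * arrangements (suc M ∸ i)
    c[1+M]≡0 : c (suc M) ≡ 0
    c[1+M]≡0 rewrite k>n⇒nCk≡0 {M} {suc M} (n<1+n M) = refl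
    c′≡ : ∀ {i} → i ≤ suc M → c′ i ≡ suc M * c i + suc M C i
    c′≡ {i} i≤1+M with m≤n⇒m<n∨m≡n i≤1+M
    ... | inj₁ i<1+M = trans (C*-recurrence arrangements 1 (λ k → +-comm 1 _) (≤-pred i<1+M))
                             (cong (suc M * c i +_) (*-identityˡ (suc M C i)))
    ... | inj₂ refl rewrite nCn≡1 (suc M) | n∸n≡0 M | c[1+M]≡0 | *-zeroʳ M = refl

  expSum-suc≤ : ∀ M x → M ! * expSum M (suc x) ≤ arrangements M * expSum M x
  expSum-suc≤ M x = begin
    M ! * expSum M (suc x)
      ≡⟨ cong (M ! *_) (expSum-suc≡poly M x) ⟩
    M ! * poly (λ i → (M C i) * arrangements (M ∸ i)) (suc M) x
      ≡⟨ poly-scale (M !) _ (suc M) x ⟨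
    poly (λ i → M ! * ((M C i) * arrangements (M ∸ i))) (suc M) x
      ≤⟨ poly-mono (suc M) x termwise ⟩
    poly (λ i → arrangements M * ((M C i) * (M ∸ i) !)) (suc M) x
      ≡⟨ poly-scale (arrangements M) _ (suc M) x ⟩
    arrangements M * poly (λ i → (M C i) * (M ∸ i) !) (suc M) x
      ≡⟨ cong (arrangements M *_) (expSum≡poly M x) ⟨
    arrangements M * expSum M x ∎
    where
    termwise : ∀ i → M ! * ((M C i) * arrangements (M ∸ i)) ≤ arrangements M * ((M C i) * (M ∸ i) !)
    termwise i = begin
      M ! * ((M C i) * arrangements (M ∸ i)) ≡⟨ x∙yz≈y∙xz (M !) (M C i) _ ⟩
      (M C i) * (M ! * arrangements (M ∸ i)) ≤⟨ *-monoʳ-≤ (M C i) (arrangements/!-mono (m∸n≤m M i)) ⟩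
      (M C i) * ((M ∸ i) ! * arrangements M) ≡⟨ x∙yz≈z∙xy (M C i) ((M ∸ i) !) (arrangements M) ⟩
      arrangements M * ((M C i) * (M ∸ i) !) ∎

  expSum-zero : ∀ M → expSum M 0 ≡ M !
  expSum-zero zero    = refl
  expSum-zero (suc M) rewrite expSum-zero M = +-identityʳ (suc M !)

  expSum-pow : ∀ M x → expSum M x * (M !) ^ x ≤ M ! * arrangements M ^ x
  expSum-pow M zero rewrite expSum-zero M = ≤-refl
  expSum-pow M (suc x) = begin
    expSum M (suc x) * (M ! * (M !) ^ x)        ≡⟨ rearrange (expSum M (suc x)) (M !) ((M !) ^ x) ⟩
    M ! * expSum M (suc x) * (M !) ^ x          ≤⟨ *-monoˡ-≤ ((M !) ^ x) (expSum-suc≤ M x) ⟩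
    arrangements M * expSum M x * (M !) ^ x     ≡⟨ *-assoc (arrangements M) (expSum M x) _ ⟩
    arrangements M * (expSum M x * (M !) ^ x)   ≤⟨ *-monoʳ-≤ (arrangements M) (expSum-pow M x) ⟩
    arrangements M * (M ! * arrangements M ^ x) ≡⟨ x∙yz≈y∙xz (arrangements M) (M !) _ ⟩
    M ! * (arrangements M * arrangements M ^ x) ∎
    where
    rearrange : ∀ e f p → e * (f * p) ≡ f * e * p
    rearrange = solve-∀

  ladderCount : ℕ → ℕ
  ladderCount zero    = 1
  ladderCount (suc m) = ladderCount m * arrangementsWith m

  -- the product over s = 1, …, m of the bounds s·s!·e_M(1) ≤ h(s)
  sf*!*arrangements^≤ladderCount : ∀ m M →
    sf m * m ! * arrangements M ^ m ≤ (M !) ^ m * ladderCount (suc m)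
  sf*!*arrangements^≤ladderCount zero    M = ≤-refl
  sf*!*arrangements^≤ladderCount (suc m) M = begin
    sf m * (suc m * m !) * (suc m * m !) * (a * a ^ m)
      ≡⟨ rearrange (sf m) (m !) a (a ^ m) m ⟩
    sf m * m ! * a ^ m * (suc m * (suc m * m !) * a)
      ≤⟨ *-mono-≤ (sf*!*arrangements^≤ladderCount m M) (arrangements/!≤arrangementsWith/[s*s!] (suc m) M) ⟩
    P * L * (M ! * arrangementsWith (suc m))
      ≡⟨ rearrange′ P L (M !) (arrangementsWith (suc m)) ⟩
    M ! * P * (L * arrangementsWith (suc m)) ∎
    where
    a = arrangements M
    P = (M !) ^ m
    L = ladderCount (suc m)
    rearrange : ∀ s f a p m → s * (suc m * f) * (suc m * f) * (a * p) ≡ s * f * p * (suc m * (suc m * f) * a)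
    rearrange = solve-∀
    rearrange′ : ∀ p l f h → p * l * (f * h) ≡ f * p * (l * h)
    rearrange′ = solve-∀

  sf*expSum≤ladderCount : ∀ m M → sf m * expSum M m ≤ 3 * suc m * ladderCount m * M !
  sf*expSum≤ladderCount m M = *-cancelˡ-≤ (m ! * P) {{m*n≢0 (m !) P {{m !≢0}} {{P≢0}}}} (begin
    m ! * P * (sf m * expSum M m)
      ≡⟨ rearrange (m !) P (sf m) (expSum M m) ⟩
    sf m * m ! * (expSum M m * P)
      ≤⟨ *-monoʳ-≤ (sf m * m !) (expSum-pow M m) ⟩
    sf m * m ! * (M ! * arrangements M ^ m)
      ≡⟨ x∙yz≈y∙xz (sf m * m !) (M !) _ ⟩
    M ! * (sf m * m ! * arrangements M ^ m)
      ≤⟨ *-monoʳ-≤ (M !) (sf*!*arrangements^≤ladderCount m M) ⟩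
    M ! * (P * (ladderCount m * arrangementsWith m))
      ≤⟨ *-monoʳ-≤ (M !) (*-monoʳ-≤ P (*-monoʳ-≤ (ladderCount m) (arrangementsWith≤3*! m))) ⟩
    M ! * (P * (ladderCount m * (3 * suc m !)))
      ≡⟨ rearrange′ (M !) P (ladderCount m) (suc m) (m !) ⟩
    m ! * P * (3 * suc m * ladderCount m * M !) ∎)
    where
    P = (M !) ^ m
    P≢0 = m^n≢0 (M !) m {{M !≢0}}
    rearrange : ∀ f p s e → f * p * (s * e) ≡ s * f * (e * p)
    rearrange = solve-∀
    rearrange′ : ∀ F p l n f → F * (p * (l * (3 * (n * f)))) ≡ f * p * (3 * n * l * F)
    rearrange′ = solve-∀

module Ladders where

  open Estimates using (arrangements; arrangementsWith; ladderCount; expSum; sf*expSum≤ladderCount)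
  open import Data.Nat as ℕ using (ℕ; zero; suc; z≤n; s≤s; _!)
  import Data.Nat.Properties as ℕ
  open import Data.Fin as Fin using (Fin; zero; suc; toℕ; inject₁; punchIn; remQuot; combine; splitAt)
  open import Data.Fin.Properties
    using (punchIn-injective; punchInᵢ≢i; combine-remQuot; join-splitAt; suc-injective; toℕ-injective;
           toℕ≤pred[n]; injective⇒≤)
  open import Data.List using (List; []; _∷_; map; length; lookup)
  open import Data.List.Properties using (∷-injective; map-injective; map-cong)
  open import Data.List.Membership.Propositional using (_∈_)
  open import Data.List.Membership.Propositional.Properties using (∈-map⁺; ∈-map⁻)
  open import Data.List.Relation.Unary.Any as Any using (here; there)
  open import Data.List.Relation.Unary.Any.Properties using (lookup-index)
  open import Data.List.Relation.Unary.All using ([]; universal)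
  open import Data.List.Relation.Unary.All.Properties using (map⁺)
  open import Data.List.Relation.Unary.AllPairs using ([]; _∷_)
  open import Data.List.Relation.Unary.Unique.Propositional using (Unique)
  import Data.List.Relation.Unary.Unique.Propositional.Properties as Unique
  open import Data.Product using (_×_; _,_; proj₁; proj₂; uncurry)
  open import Data.Sum using (inj₁; inj₂)
  open import Function using (_∘_)
  open import Function.Bundles using (Inverse; Injection)
  open import Function.Properties.Inverse using (↔⇒↣)
  open import Relation.Binary.PropositionalEquality

  remQuot-injective : ∀ {n} k {i j : Fin (n ℕ.* k)} → remQuot {n} k i ≡ remQuot k j → i ≡ j
  remQuot-injective {n} k {i} {j} eq =
    trans (sym (combine-remQuot {n} k i)) (trans (cong (uncurry combine) eq) (combine-remQuot {n} k j))

  splitAt-injective : ∀ m {n} {i j : Fin (m ℕ.+ n)} → splitAt m i ≡ splitAt m j → i ≡ j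
  splitAt-injective m {n} {i} {j} eq =
    trans (sym (join-splitAt m n i)) (trans (cong (Fin.join m n) eq) (join-splitAt m n j))

  consFresh : ∀ {n} → Fin (suc n) → List (Fin n) → List (Fin (suc n))
  consFresh x ys = x ∷ map (punchIn x) ys

  consFresh-unique : ∀ {n} (x : Fin (suc n)) {ys} → Unique ys → Unique (consFresh x ys)
  consFresh-unique x ys-unique =
    map⁺ (universal (λ y x≡x↑y → punchInᵢ≢i x y (sym x≡x↑y)) _)
      ∷ Unique.map⁺ (punchIn-injective x _ _) ys-unique

  consFresh-injective : ∀ {n} {x x′ : Fin (suc n)} {ys ys′} →
    consFresh x ys ≡ consFresh x′ ys′ → x ≡ x′ × ys ≡ ys′
  consFresh-injective {x = x} eq with refl ← proj₁ (∷-injective eq) =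
    refl , map-injective (punchIn-injective x _ _) (proj₂ (∷-injective eq))

  arrangement : (s : ℕ) → Fin (arrangements s) → List (Fin s)
  arrangement zero    _       = []
  arrangement (suc s) zero    = []
  arrangement (suc s) (suc r) =
    uncurry (λ x r′ → consFresh x (arrangement s r′)) (remQuot {suc s} (arrangements s) r)

  arrangement-unique : ∀ s r → Unique (arrangement s r)
  arrangement-unique zero    _       = []
  arrangement-unique (suc s) zero    = []
  arrangement-unique (suc s) (suc r) = consFresh-unique _ (arrangement-unique s _)

  arrangement-injective : ∀ s {r r′} → arrangement s r ≡ arrangement s r′ → r ≡ r′
  arrangement-injective zero    {zero}  {zero}   _  = refl
  arrangement-injective (suc s) {zero}  {zero}   _  = refl
  arrangement-injective (suc s) {suc r} {suc r′} eq with consFresh-injective eq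
  ... | x≡x′ , eq′ =
    cong suc (remQuot-injective {suc s} (arrangements s) (cong₂ _,_ x≡x′ (arrangement-injective s eq′)))

  arrangementWith0 : (s : ℕ) → Fin (arrangementsWith s) → List (Fin (suc s))
  arrangementWith0 zero    _ = zero ∷ []
  arrangementWith0 (suc s) r with splitAt (arrangements (suc s)) r
  ... | inj₁ r₁ = consFresh zero (arrangement (suc s) r₁)
  ... | inj₂ r₂ =
    uncurry (λ x r′ → consFresh (suc x) (arrangementWith0 s r′)) (remQuot {suc s} (arrangementsWith s) r₂)

  arrangementWith0-∋0 : ∀ s r → zero ∈ arrangementWith0 s r
  arrangementWith0-∋0 zero    _ = here refl
  arrangementWith0-∋0 (suc s) r with splitAt (arrangements (suc s)) r
  ... | inj₁ _  = here refl
  ... | inj₂ r₂ = there (∈-map⁺ _ (arrangementWith0-∋0 s _))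

  arrangementWith0-unique : ∀ s r → Unique (arrangementWith0 s r)
  arrangementWith0-unique zero    _ = [] ∷ []
  arrangementWith0-unique (suc s) r with splitAt (arrangements (suc s)) r
  ... | inj₁ r₁ = consFresh-unique zero (arrangement-unique (suc s) r₁)
  ... | inj₂ r₂ = consFresh-unique _ (arrangementWith0-unique s _)

  arrangementWith0-injective : ∀ s {r r′} → arrangementWith0 s r ≡ arrangementWith0 s r′ → r ≡ r′
  arrangementWith0-injective zero {zero} {zero} _ = refl
  arrangementWith0-injective (suc s) {r} {r′} eq
    with splitAt (arrangements (suc s)) r in split | splitAt (arrangements (suc s)) r′ in split′
  ... | inj₁ r₁ | inj₁ r₁′ =
    splitAt-injective (arrangements (suc s)) (trans split (trans (cong inj₁ r₁≡r₁′) (sym split′)))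
    where
    r₁≡r₁′ = arrangement-injective (suc s) (proj₂ (consFresh-injective eq))
  ... | inj₁ _ | inj₂ _ with () ← proj₁ (∷-injective eq)
  ... | inj₂ _ | inj₁ _ with () ← proj₁ (∷-injective eq)
  ... | inj₂ r₂ | inj₂ r₂′ with consFresh-injective eq
  ... | x≡x′ , eq′ =
    splitAt-injective (arrangements (suc s)) (trans split (trans (cong inj₂ r₂≡r₂′) (sym split′)))
    where
    r₂≡r₂′ = remQuot-injective {suc s} (arrangementsWith s)
      (cong₂ _,_ (suc-injective x≡x′) (arrangementWith0-injective s eq′))

  ladderOut : (m : ℕ) → Fin (ladderCount m) → Fin (suc m) → List (Fin (suc m))
  ladderOut zero    _ _       = []
  ladderOut (suc m) r zero    = map suc (arrangementWith0 m (proj₂ (remQuot {ladderCount m} (arrangementsWith m) r)))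
  ladderOut (suc m) r (suc j) = map suc (ladderOut m (proj₁ (remQuot {ladderCount m} (arrangementsWith m) r)) j)

  ladderOut-increasing : ∀ m r {u v} → v ∈ ladderOut m r u → u Fin.< v
  ladderOut-increasing (suc m) r {zero}  v∈ with ∈-map⁻ suc v∈
  ... | _ , _ , refl = s≤s z≤n
  ladderOut-increasing (suc m) r {suc j} v∈ with ∈-map⁻ suc v∈
  ... | _ , w∈ , refl = s≤s (ladderOut-increasing m _ w∈)

  ladderOut-next : ∀ m r (j : Fin m) → suc j ∈ ladderOut m r (inject₁ j)
  ladderOut-next (suc m) r zero    = ∈-map⁺ suc (arrangementWith0-∋0 m _)
  ladderOut-next (suc m) r (suc j) = ∈-map⁺ suc (ladderOut-next m _ j)

  ladderOut-unique : ∀ m r u → Unique (ladderOut m r u)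
  ladderOut-unique zero    _ _       = []
  ladderOut-unique (suc m) r zero    = Unique.map⁺ suc-injective (arrangementWith0-unique m _)
  ladderOut-unique (suc m) r (suc j) = Unique.map⁺ suc-injective (ladderOut-unique m _ j)

  ladderOut-injective : ∀ m {r r′} → (∀ u → ladderOut m r u ≡ ladderOut m r′ u) → r ≡ r′
  ladderOut-injective zero    {zero} {zero} _ = refl
  ladderOut-injective (suc m) eq = remQuot-injective {ladderCount m} (arrangementsWith m) (cong₂ _,_
    (ladderOut-injective m (λ j → map-injective suc-injective (eq (suc j))))
    (arrangementWith0-injective m (map-injective suc-injective (eq zero))))

  ladderPath-increasing : ∀ m r {u w} → Path⁺ (ladderOut m r) u w → u Fin.< w
  ladderPath-increasing m r (edge v∈)   = ladderOut-increasing m r v∈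
  ladderPath-increasing m r (step v∈ p) =
    ℕ.<-trans (ladderOut-increasing m r v∈) (ladderPath-increasing m r p)

  ladder : (m : ℕ) → Fin (ladderCount m) → DOAG (suc m)
  ladder m r = record
    { out           = ladderOut m r
    ; out-unique    = ladderOut-unique m r
    ; acyclic       = λ v p → ℕ.<-irrefl refl (ladderPath-increasing m r p)
    ; srcs          = zero ∷ []
    ; srcs-unique   = [] ∷ []
    ; srcs-sound    = sound
    ; srcs-complete = complete
    }
    where
    sound : ∀ v → v ∈ zero ∷ [] → IsSource (ladderOut m r) v
    sound _ (here refl) u 0∈ with () ← ladderOut-increasing m r 0∈
    complete : ∀ v → IsSource (ladderOut m r) v → v ∈ zero ∷ []
    complete zero    _      = here refl
    complete (suc j) source with () ← source (inject₁ j) (ladderOut-next m r j)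

  StepIncreasing : ∀ {m k} → (Fin (suc m) → Fin k) → Set
  StepIncreasing {m} f = (j : Fin m) → f (inject₁ j) Fin.< f (suc j)

  stepIncreasing-lower : ∀ {m k} (f : Fin (suc m) → Fin k) → StepIncreasing f →
    ∀ i → toℕ i ℕ.+ toℕ (f zero) ℕ.≤ toℕ (f i)
  stepIncreasing-lower         f f↑ zero    = ℕ.≤-refl
  stepIncreasing-lower {suc _} f f↑ (suc j) = begin
    suc (toℕ j ℕ.+ toℕ (f zero)) ≡⟨ ℕ.+-suc (toℕ j) _ ⟨
    toℕ j ℕ.+ suc (toℕ (f zero)) ≤⟨ ℕ.+-monoʳ-≤ (toℕ j) (f↑ zero) ⟩
    toℕ j ℕ.+ toℕ (f (suc zero)) ≤⟨ stepIncreasing-lower (f ∘ suc) (f↑ ∘ suc) j ⟩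
    toℕ (f (suc j))              ∎
    where open ℕ.≤-Reasoning

  stepIncreasing-upper : ∀ {m k} (f : Fin (suc m) → Fin (suc k)) → StepIncreasing f →
    ∀ i → toℕ (f i) ℕ.+ (m ℕ.∸ toℕ i) ℕ.≤ k
  stepIncreasing-upper {zero}  f f↑ zero    =
    ℕ.≤-trans (ℕ.≤-reflexive (ℕ.+-identityʳ _)) (toℕ≤pred[n] (f zero))
  stepIncreasing-upper {suc m} f f↑ zero    = begin
    toℕ (f zero) ℕ.+ suc m   ≡⟨ ℕ.+-suc (toℕ (f zero)) m ⟩
    suc (toℕ (f zero)) ℕ.+ m ≤⟨ ℕ.+-monoˡ-≤ m (f↑ zero) ⟩
    toℕ (f (suc zero)) ℕ.+ m ≤⟨ stepIncreasing-upper (f ∘ suc) (f↑ ∘ suc) zero ⟩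
    _                        ∎
    where open ℕ.≤-Reasoning
  stepIncreasing-upper {suc m} f f↑ (suc j) = stepIncreasing-upper (f ∘ suc) (f↑ ∘ suc) j

  stepIncreasing⇒≗id : ∀ {m} (f : Fin (suc m) → Fin (suc m)) → StepIncreasing f → ∀ i → f i ≡ i
  stepIncreasing⇒≗id {m} f f↑ i = toℕ-injective (ℕ.≤-antisym f[i]≤i i≤f[i])
    where
    i≤f[i] : toℕ i ℕ.≤ toℕ (f i)
    i≤f[i] = ℕ.≤-trans (ℕ.m≤m+n (toℕ i) _) (stepIncreasing-lower f f↑ i)
    f[i]≤i : toℕ (f i) ℕ.≤ toℕ i
    f[i]≤i = ℕ.+-cancelʳ-≤ (m ℕ.∸ toℕ i) (toℕ (f i)) (toℕ i)
      (ℕ.≤-trans (stepIncreasing-upper f f↑ i) (ℕ.≤-reflexive (sym (ℕ.m+[n∸m]≡n (toℕ≤pred[n] i)))))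

  ≅-edge : ∀ {n} {G H : DOAG n} (iso : G ≅ H) {u v} → v ∈ DOAG.out G u →
    Inverse.to (proj₁ iso) v ∈ DOAG.out H (Inverse.to (proj₁ iso) u)
  ≅-edge (σ , σ-out , _) {u} v∈ = subst (_ ∈_) (σ-out u) (∈-map⁺ (Inverse.to σ) v∈)

  ≅-edge⁻ : ∀ {n} {G H : DOAG n} (iso : G ≅ H) {u v} → v ∈ DOAG.out H u →
    Inverse.from (proj₁ iso) v ∈ DOAG.out G (Inverse.from (proj₁ iso) u)
  ≅-edge⁻ {G = G} {H} (σ , σ-out , _) {u} {v} v∈ with ∈-map⁻ (Inverse.to σ) v∈′
    where
    v∈′ : v ∈ map (Inverse.to σ) (DOAG.out G (Inverse.from σ u))
    v∈′ = subst (v ∈_) (trans (cong (DOAG.out H) (sym (Inverse.strictlyInverseˡ σ u))) (sym (σ-out _))) v∈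
  ... | w , w∈ , refl = subst (_∈ DOAG.out G _) (sym (Inverse.strictlyInverseʳ σ w)) w∈

  -- σ′⁻¹ ∘ σ sends the edge j → j + 1 of ladder r to an upward edge of ladder r′, hence it is
  -- the identity, and σ, σ′ transport the out-lists of both ladders to the same lists of H.
  ladder-≅-injective : ∀ {m} r r′ {H : DOAG (suc m)} → ladder m r ≅ H → ladder m r′ ≅ H → r ≡ r′
  ladder-≅-injective {m} r r′ {H} iso@(σ , σ-out , _) iso′@(σ′ , σ′-out , _) =
    ladderOut-injective m (λ v → map-injective to′-injective (begin
      map to′ (ladderOut m r v)   ≡⟨ map-cong to≗to′ (ladderOut m r v) ⟨
      map to (ladderOut m r v)    ≡⟨ σ-out v ⟩
      DOAG.out H (to v)           ≡⟨ cong (DOAG.out H) (to≗to′ v) ⟩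
      DOAG.out H (to′ v)          ≡⟨ σ′-out v ⟨
      map to′ (ladderOut m r′ v)  ∎))
    where
    open ≡-Reasoning
    to = Inverse.to σ
    to′ = Inverse.to σ′
    to′-injective : ∀ {x y} → to′ x ≡ to′ y → x ≡ y
    to′-injective = Injection.injective (↔⇒↣ σ′)
    τ : Fin (suc m) → Fin (suc m)
    τ = Inverse.from σ′ ∘ to
    τ↑ : StepIncreasing τ
    τ↑ j = ladderOut-increasing m r′
      (≅-edge⁻ {G = ladder m r′} {H} iso′ (≅-edge {G = ladder m r} {H} iso (ladderOut-next m r j)))
    to≗to′ : ∀ v → to v ≡ to′ v
    to≗to′ v = trans (sym (Inverse.strictlyInverseˡ σ′ _)) (cong to′ (stepIncreasing⇒≗id τ τ↑ v))

  ladderCount≤ : ∀ m {k} → IsDOAGCount (suc m) k → ladderCount m ℕ.≤ k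
  ladderCount≤ m (L , refl , _ , cover) = injective⇒≤ {f = index} index-injective
    where
    index : Fin (ladderCount m) → Fin (length L)
    index r = Any.index (cover (ladder m r))
    index-injective : ∀ {r r′} → index r ≡ index r′ → r ≡ r′
    index-injective {r} {r′} eq = ladder-≅-injective r r′ {lookup L (index r)} (lookup-index (cover (ladder m r)))
      (subst (λ i → ladder m r′ ≅ lookup L i) (sym eq) (lookup-index (cover (ladder m r′))))

  sf*expSum≤DOAGCount : ∀ m {k} → IsDOAGCount (suc m) k → ∀ M →
    sf m ℕ.* expSum M m ℕ.≤ 3 ℕ.* suc m ℕ.* k ℕ.* M !
  sf*expSum≤DOAGCount m count M = ℕ.≤-trans (sf*expSum≤ladderCount m M)
    (ℕ.*-monoˡ-≤ (M !) (ℕ.*-monoʳ-≤ (3 ℕ.* suc m) (ladderCount≤ m count)))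

module Fractions where

  open Estimates using (expSum)
  open import Data.Nat as ℕ using (ℕ; zero; suc; _!; NonZero)
  open import Data.Nat.Properties using (_!≢0; m*n≢0; *-identityʳ)
  open import Data.Nat.Tactic.RingSolver using (solve-∀)
  open import Data.Integer as ℤ using (+_)
  import Data.Integer.Properties as ℤ
  open import Data.Rational as ℚ using (toℚᵘ)
  import Data.Rational.Properties as ℚ
  open import Data.Rational.Unnormalised as ℚᵘ using (ℚᵘ; mkℚᵘ; *≡*; *≤*)
  import Data.Rational.Unnormalised.Properties as ℚᵘ
  open import Relation.Binary.PropositionalEquality

  infix 7 _÷_

  _÷_ : ℕ → (d : ℕ) → .{{NonZero d}} → ℚᵘ
  n ÷ d = + n ℚᵘ./ d

  toℚᵘ-/ : ∀ n d .{{_ : NonZero d}} → toℚᵘ (+ n ℚ./ d) ℚᵘ.≃ n ÷ d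
  toℚᵘ-/ n (suc d) = ℚ.toℚᵘ-fromℚᵘ (mkℚᵘ (+ n) d)

  ÷-+ : ∀ a b c d e f .{{_ : NonZero b}} .{{_ : NonZero d}} .{{_ : NonZero f}} →
    (a ℕ.* d ℕ.+ c ℕ.* b) ℕ.* f ≡ e ℕ.* (b ℕ.* d) → a ÷ b ℚᵘ.+ c ÷ d ℚᵘ.≃ e ÷ f
  ÷-+ a (suc b) c (suc d) e (suc f) eq = *≡* (begin
    (+ a ℤ.* + suc d ℤ.+ + c ℤ.* + suc b) ℤ.* + suc f
      ≡⟨ cong (ℤ._* + suc f) (cong₂ ℤ._+_ (ℤ.pos-* a (suc d)) (ℤ.pos-* c (suc b))) ⟨
    (+ (a ℕ.* suc d) ℤ.+ + (c ℕ.* suc b)) ℤ.* + suc f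
      ≡⟨ cong (ℤ._* + suc f) (ℤ.pos-+ (a ℕ.* suc d) (c ℕ.* suc b)) ⟨
    + (a ℕ.* suc d ℕ.+ c ℕ.* suc b) ℤ.* + suc f
      ≡⟨ ℤ.pos-* (a ℕ.* suc d ℕ.+ c ℕ.* suc b) (suc f) ⟨
    + ((a ℕ.* suc d ℕ.+ c ℕ.* suc b) ℕ.* suc f)
      ≡⟨ cong +_ eq ⟩
    + (e ℕ.* (suc b ℕ.* suc d))
      ≡⟨ ℤ.pos-* e (suc b ℕ.* suc d) ⟩
    + e ℤ.* + (suc b ℕ.* suc d) ∎)
    where open ≡-Reasoning

  ÷-* : ∀ a b c d e f .{{_ : NonZero b}} .{{_ : NonZero d}} .{{_ : NonZero f}} →
    a ℕ.* c ℕ.* f ≡ e ℕ.* (b ℕ.* d) → (a ÷ b) ℚᵘ.* (c ÷ d) ℚᵘ.≃ e ÷ f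
  ÷-* a (suc b) c (suc d) e (suc f) eq = *≡* (begin
    + a ℤ.* + c ℤ.* + suc f     ≡⟨ cong (ℤ._* + suc f) (ℤ.pos-* a c) ⟨
    + (a ℕ.* c) ℤ.* + suc f     ≡⟨ ℤ.pos-* (a ℕ.* c) (suc f) ⟨
    + (a ℕ.* c ℕ.* suc f)       ≡⟨ cong +_ eq ⟩
    + (e ℕ.* (suc b ℕ.* suc d)) ≡⟨ ℤ.pos-* e (suc b ℕ.* suc d) ⟩
    + e ℤ.* + (suc b ℕ.* suc d) ∎)
    where open ≡-Reasoning

  ÷-mono-≤ : ∀ a b c d .{{_ : NonZero b}} .{{_ : NonZero d}} →
    a ℕ.* d ℕ.≤ c ℕ.* b → a ÷ b ℚᵘ.≤ c ÷ d
  ÷-mono-≤ a (suc b) c (suc d) ad≤cb =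
    *≤* (subst₂ ℤ._≤_ (ℤ.pos-* a (suc d)) (ℤ.pos-* c (suc b)) (ℤ.+≤+ ad≤cb))

  open ℚᵘ.≤-Reasoning

  expPartial≃expSum÷! : ∀ x M → toℚᵘ (expPartial x M) ℚᵘ.≃ (expSum M x ÷ M !) {{M !≢0}}
  expPartial≃expSum÷! x zero    = toℚᵘ-/ 1 1
  expPartial≃expSum÷! x (suc M) = begin-equality
    toℚᵘ (expPartial x (suc M))
      ≃⟨ ℚ.toℚᵘ-homo-+ (expPartial x M) _ ⟩
    toℚᵘ (expPartial x M) ℚᵘ.+ toℚᵘ (+ (x ℕ.^ suc M) ℚ./ suc M !)
      ≃⟨ ℚᵘ.+-cong (expPartial≃expSum÷! x M) (toℚᵘ-/ (x ℕ.^ suc M) (suc M !)) ⟩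
    expSum M x ÷ M ! ℚᵘ.+ (x ℕ.^ suc M) ÷ suc M !
      ≃⟨ ÷-+ (expSum M x) (M !) (x ℕ.^ suc M) (suc M !) (expSum (suc M) x) (suc M !)
             (rearrange (expSum M x) (x ℕ.^ suc M) (M !) M) ⟩
    expSum (suc M) x ÷ suc M ! ∎
    where
    instance
      _ = M !≢0
      _ = suc M !≢0
    rearrange : ∀ e p f M →
      (e ℕ.* (suc M ℕ.* f) ℕ.+ p ℕ.* f) ℕ.* (suc M ℕ.* f)
        ≡ (suc M ℕ.* e ℕ.+ p) ℕ.* (f ℕ.* (suc M ℕ.* f))
    rearrange = solve-∀

  ⅓*fromℕ*expPartial≤fromℕ*fromℕ : ∀ a x M b c → a ℕ.* expSum M x ℕ.≤ 3 ℕ.* b ℕ.* c ℕ.* M ! →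
    + 1 ℚ./ 3 ℚ.* fromℕ a ℚ.* expPartial x M ℚ.≤ fromℕ b ℚ.* fromℕ c
  ⅓*fromℕ*expPartial≤fromℕ*fromℕ a x M b c bound = ℚ.toℚᵘ-cancel-≤ (begin
    toℚᵘ (⅓ ℚ.* fromℕ a ℚ.* expPartial x M)
      ≃⟨ ℚ.toℚᵘ-homo-* (⅓ ℚ.* fromℕ a) (expPartial x M) ⟩
    toℚᵘ (⅓ ℚ.* fromℕ a) ℚᵘ.* toℚᵘ (expPartial x M)
      ≃⟨ ℚᵘ.*-cong ⅓*a≃ (expPartial≃expSum÷! x M) ⟩
    ((1 ÷ 3) ℚᵘ.* (a ÷ 1)) ℚᵘ.* (expSum M x ÷ M !)
      ≃⟨ ℚᵘ.*-congʳ {expSum M x ÷ M !} (÷-* 1 3 a 1 a 3 (rearrange a)) ⟩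
    (a ÷ 3) ℚᵘ.* (expSum M x ÷ M !)
      ≃⟨ ÷-* a 3 (expSum M x) (M !) _ (3 ℕ.* M !) refl ⟩
    (a ℕ.* expSum M x) ÷ (3 ℕ.* M !)
      ≤⟨ ÷-mono-≤ _ _ _ _ cleared ⟩
    (b ℕ.* c) ÷ 1
      ≃⟨ ÷-* b 1 c 1 (b ℕ.* c) 1 (rearrange′ b c) ⟨
    (b ÷ 1) ℚᵘ.* (c ÷ 1)
      ≃⟨ ℚᵘ.*-cong (toℚᵘ-/ b 1) (toℚᵘ-/ c 1) ⟨
    toℚᵘ (fromℕ b) ℚᵘ.* toℚᵘ (fromℕ c)
      ≃⟨ ℚ.toℚᵘ-homo-* (fromℕ b) (fromℕ c) ⟨
    toℚᵘ (fromℕ b ℚ.* fromℕ c) ∎)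
    where
    instance
      _ = M !≢0
      _ = m*n≢0 3 (M !)
    ⅓ = + 1 ℚ./ 3
    ⅓*a≃ : toℚᵘ (⅓ ℚ.* fromℕ a) ℚᵘ.≃ (1 ÷ 3) ℚᵘ.* (a ÷ 1)
    ⅓*a≃ = ℚᵘ.≃-trans (ℚ.toℚᵘ-homo-* ⅓ (fromℕ a)) (ℚᵘ.*-cong (toℚᵘ-/ 1 3) (toℚᵘ-/ a 1))
    rearrange : ∀ a → 1 ℕ.* a ℕ.* 3 ≡ a ℕ.* (3 ℕ.* 1)
    rearrange = solve-∀
    rearrange′ : ∀ b c → b ℕ.* c ℕ.* 1 ≡ b ℕ.* c ℕ.* (1 ℕ.* 1)
    rearrange′ = solve-∀
    cleared : a ℕ.* expSum M x ℕ.* 1 ℕ.≤ b ℕ.* c ℕ.* (3 ℕ.* M !)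
    cleared = subst₂ ℕ._≤_ (sym (*-identityʳ _)) (rearrange″ b c (M !)) bound
      where
      rearrange″ : ∀ b c f → 3 ℕ.* b ℕ.* c ℕ.* f ≡ b ℕ.* c ℕ.* (3 ℕ.* f)
      rearrange″ = solve-∀

open import Data.Nat using (ℕ; _≤_; _∸_)
open import Data.Rational using (ℚ; _*_; 0ℚ) renaming (_≤_ to _≤ℚ_; _<_ to _<ℚ_)
open import Data.Product using (Σ; _×_; _,_)
open import Data.Nat using (zero; suc)
open import Data.Integer using (+_)
open import Data.Rational using (_/_)
open import Data.Rational.Properties using (positive⁻¹)
open Ladders using (sf*expSum≤DOAGCount)
open Fractions using (⅓*fromℕ*expPartial≤fromℕ*fromℕ)

lemma5p3 : Σ ℚ λ A → (0ℚ <ℚ A) ×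
    ((n : ℕ) → 1 ≤ n → (k : ℕ) → IsDOAGCount n k →
    (m : ℕ) →
    A * fromℕ (sf (n ∸ 1)) * expPartial (n ∸ 1) m ≤ℚ fromℕ n * fromℕ k)
lemma5p3 = + 1 / 3 , positive⁻¹ _ , bound
  where
  bound : (n : ℕ) → 1 ≤ n → (k : ℕ) → IsDOAGCount n k → (m : ℕ) →
    + 1 / 3 * fromℕ (sf (n ∸ 1)) * expPartial (n ∸ 1) m ≤ℚ fromℕ n * fromℕ k
  bound zero    ()
  bound (suc m) _ k count M =
    ⅓*fromℕ*expPartial≤fromℕ*fromℕ (sf m) m M (suc m) k (sf*expSum≤DOAGCount m count M)
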